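{- Let $n\ge 3$ and let $C$ be the directed cycle $v_1v_2\dots v_nv_1$ (arcs $v_iv_{i+1}$ for $1\le i\le n-1$ and $v_nv_1$). Then $\chi_d(C)=n$.
   Context: For a digraph $D$ and $v\in V(D)$, $N^+(v)=\{u: vu\in A(D)\}$. A dominator coloring of $D$ is a partition of $V(D)$ into color classes such that (i) it is a proper coloring of the underlying graph (adjacent vertices receive different colors), and (ii) every vertex $v$ with at least one out-neighbor dominates some color class, i.e., there is a color class $C'$ with $C'\subseteq N^+(v)$. $\chi_d(D)$ is the minimum number of color classes in a dominator coloring of $D$. -}

module Defs where

open import Data.Nat using (ℕ; suc; _∸_; _≤_)
open import Data.Fin using (Fin; toℕ)
open import Data.Product using (Σ; ∃; _×_; _,_)
open import Data.Sum using (_⊎_)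
open import Relation.Binary.PropositionalEquality using (_≡_; _≢_)
open import Relation.Nullary using (¬_)
open import Function.Definitions using (Surjective)

Digraph : ℕ → Set₁
Digraph n = Fin n → Fin n → Set

Adjacent : ∀ {n} → Digraph n → Fin n → Fin n → Set
Adjacent D u v = D u v ⊎ D v u

-- A colouring with exactly k colour classes: a surjection c : V → Fin k
-- (the colour classes are the fibres c⁻¹(j), all nonempty).
-- Dominator colouring with exactly k colour classes.
record DominatorColoring {n} (D : Digraph n) (k : ℕ) : Set where
  field
    colour    : Fin n → Fin k
    classes   : Surjective _≡_ _≡_ colour
    proper    : ∀ u v → Adjacent D u v → colour u ≢ colour v
    dominates : ∀ v → (∃ λ w → D v w) →
                ∃ λ j → ∀ u → colour u ≡ j → D v u

χd≡ : ∀ {n} → Digraph n → ℕ → Set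
χd≡ D m = DominatorColoring D m × (∀ k → DominatorColoring D k → m ≤ k)

-- Directed cycle v₀ v₁ … v_{n-1} v₀ (0-indexed): arcs i → i+1 and (n-1) → 0.
DirectedCycle : (n : ℕ) → Digraph n
DirectedCycle n i j = (toℕ j ≡ suc (toℕ i)) ⊎ ((toℕ i ≡ n ∸ 1) × (toℕ j ≡ 0))

module Submission where

open import Defs
open import Data.Nat using (ℕ; _≤_; suc; s≤s)
open import Data.Nat.Properties using (<-irrefl; n<1+n; 1+n≢0)
open import Data.Fin using (Fin; toℕ; fromℕ; inject₁) renaming (zero to fzero; suc to fsuc)
open import Data.Fin.Properties using (toℕ-injective; toℕ<n; toℕ-fromℕ; toℕ-inject₁; injective⇒≤)
open import Data.Product using (∃; _,_)
open import Data.Sum using (inj₁; inj₂)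
open import Data.Empty using (⊥-elim)
open import Function.Definitions using (Injective)
open import Relation.Binary.PropositionalEquality using (_≡_; refl; sym; trans; cong; subst)
open import Relation.Nullary using (¬_)

-- Upper bound: colouring every vertex with its own colour works as soon as there are no loops,
-- since every singleton {w} is a colour class.  Lower bound: if every vertex x has an in-neighbour
-- p and p has no other out-neighbour, the class dominated by p must be {x}; hence all singletons
-- are colour classes and the colouring is injective.  The directed cycle has both properties.

Loopless : ∀ {n} → Digraph n → Set
Loopless D = ∀ v → ¬ D v v

OutFunctional : ∀ {n} → Digraph n → Set
OutFunctional D = ∀ {v a b} → D v a → D v b → a ≡ b

HasInNeighbours : ∀ {n} → Digraph n → Set
HasInNeighbours D = ∀ x → ∃ λ p → D p x

discreteColoring : ∀ {n} {D : Digraph n} → Loopless D → DominatorColoring D n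
discreteColoring {D = D} loopless = record
  { colour    = λ v → v
  ; classes   = λ v → v , λ v′≡v → v′≡v
  ; proper    = λ { u _ (inj₁ uv) refl → loopless u uv ; u _ (inj₂ uv) refl → loopless u uv }
  ; dominates = λ { v (w , vw) → w , λ u u≡w → subst (D v) (sym u≡w) vw }
  }

module _ {n k} {D : Digraph n} (out-functional : OutFunctional D) (in-neighbours : HasInNeighbours D)
         (c : DominatorColoring D k) where
  open DominatorColoring c

  dominatorColoring-injective : Injective _≡_ _≡_ colour
  dominatorColoring-injective {x} {y} cx≡cy with in-neighbours x
  ... | p , px with dominates p (x , px)
  ... | j , p-dominates-j with classes j
  ... | u , cu≡j = out-functional px (p-dominates-j y (trans (sym cx≡cy) cx≡j))
    where
    u≡x : u ≡ x
    u≡x = out-functional (p-dominates-j u (cu≡j refl)) px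

    cx≡j : colour x ≡ j
    cx≡j = subst (λ z → colour z ≡ j) u≡x (cu≡j refl)

  dominatorColoring-size : n ≤ k
  dominatorColoring-size = injective⇒≤ dominatorColoring-injective

cycle-loopless : ∀ n → Loopless (DirectedCycle (suc (suc n)))
cycle-loopless n u (inj₁ u→u) = <-irrefl u→u (n<1+n (toℕ u))
cycle-loopless n u (inj₂ (u≡last , u≡0)) = 1+n≢0 (trans (sym u≡last) u≡0)

cycle-outFunctional : ∀ n → OutFunctional (DirectedCycle (suc n))
cycle-outFunctional n (inj₁ a≡1+v) (inj₁ b≡1+v) = toℕ-injective (trans a≡1+v (sym b≡1+v))
cycle-outFunctional n (inj₂ (_ , a≡0)) (inj₂ (_ , b≡0)) = toℕ-injective (trans a≡0 (sym b≡0))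
cycle-outFunctional n {a = a} (inj₁ a≡1+v) (inj₂ (v≡n , _)) =
  ⊥-elim (<-irrefl (trans a≡1+v (cong suc v≡n)) (toℕ<n a))
cycle-outFunctional n {b = b} (inj₂ (v≡n , _)) (inj₁ b≡1+v) =
  ⊥-elim (<-irrefl (trans b≡1+v (cong suc v≡n)) (toℕ<n b))

cycle-inNeighbours : ∀ n → HasInNeighbours (DirectedCycle (suc n))
cycle-inNeighbours n fzero    = fromℕ n , inj₂ (toℕ-fromℕ n , refl)
cycle-inNeighbours n (fsuc x) = inject₁ x , inj₁ (cong suc (sym (toℕ-inject₁ x)))

proposition2 : (n : ℕ) → 3 ≤ n → χd≡ (DirectedCycle n) n
proposition2 (suc (suc (suc m))) (s≤s (s≤s (s≤s _))) =
    discreteColoring (cycle-loopless (suc m))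
  , λ k → dominatorColoring-size (cycle-outFunctional (suc (suc m))) (cycle-inNeighbours (suc (suc m)))
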